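{- Let $G=(A\cup B,E)$ be an instance of the super-stable matching problem with incomplete lists and ties, let $(m,w)\in E$, and let $G'$ be the reduced graph of $G$ with respect to $(m,w)$ (defined in the context). If $M'$ is a super-stable matching in $G'$ such that $M'\cup\{(m,w)\}$ is a super-stable matching in $G$, then for every super-stable matching $N'$ in $G'$, $N'\cup\{(m,w)\}$ is a super-stable matching in $G$. Moreover, if $G'$ has no super-stable matching, then $G$ has no super-stable matching containing $(m,w)$.
   Context: An instance is a bipartite graph $G=(A\cup B,E)$ ($A$ = men, $B$ = women) in which each vertex $x$ ranks its neighbours in a linearly ordered list of ties (a weak order); $y_1\succ_x y_2$ means $x$ strictly prefers $y_1$ to $y_2$, $y_1=_x y_2$ means indifference, and $y_1\succeq_x y_2$ (equivalently $y_2\preceq_x y_1$) means $y_1\succ_x y_2$ or $y_1=_x y_2$. For a matching $M$, $M(x)$ is the partner of a matched vertex $x$. An edge $(x,y)\in E\setminus M$ blocks $M$ if ($x$ is unmatched in $M$ or $y\succeq_x M(x)$) and ($y$ is unmatched in $M$ or $x\succeq_y M(y)$); $M$ is super-stable (in a given graph) if no edge of that graph blocks it. The reduced graph $G'$ with respect to $(m,w)$ is obtained from $G$ by: deleting the vertices $m$ and $w$ together with all edges incident to them; then, for every $m'$ with $(m',w)\in E$ and $m\preceq_w m'$, deleting every edge $(m',w')$ with $w\succeq_{m'} w'$; and, for every $w'$ with $(m,w')\in E$ and $w\preceq_m w'$, deleting every edge $(m',w')$ with $m\succeq_{w'} m'$. -}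

module Defs where

open import Data.Nat using (ℕ; _≤_)
open import Data.Fin using (Fin)
open import Data.Product using (_×_; Σ; ∃)
open import Data.Sum using (_⊎_)
open import Relation.Nullary using (¬_)
open import Relation.Binary.PropositionalEquality using (_≡_; _≢_)

-- An instance: men = Fin nA, women = Fin nB, an edge relation E, and for every
-- vertex a weak order (list of ties) on its neighbours, given by a rank
-- function: smaller rank = more preferred, equal rank = tie.
--   y₁ ⪰ₓ y₂  iff  rank x y₁ ≤ rank x y₂.
-- (Ranks of non-neighbours are never consulted.)
record Instance : Set₁ where
  field
    nA nB  : ℕ
    E      : Fin nA → Fin nB → Set
    rankA  : Fin nA → Fin nB → ℕ
    rankB  : Fin nB → Fin nA → ℕ

module _ (I : Instance) where
  open Instance I

  Graph : Set₁
  Graph = Fin nA → Fin nB → Set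

  Match : Set₁
  Match = Fin nA → Fin nB → Set

  _⪰ᴬ[_]_ : Fin nB → Fin nA → Fin nB → Set
  y ⪰ᴬ[ x ] y' = rankA x y ≤ rankA x y'

  _⪰ᴮ[_]_ : Fin nA → Fin nB → Fin nA → Set
  x ⪰ᴮ[ y ] x' = rankB y x ≤ rankB y x'

  IsMatching : Graph → Match → Set
  IsMatching F M =
    (∀ a b → M a b → F a b) ×
    (∀ a b b' → M a b → M a b' → b ≡ b') ×
    (∀ a a' b → M a b → M a' b → a ≡ a')

  Blocks : Match → Fin nA → Fin nB → Set
  Blocks M a b =
    ¬ M a b ×
    (∀ b' → M a b' → b ⪰ᴬ[ a ] b') ×
    (∀ a' → M a' b → a ⪰ᴮ[ b ] a')

  SuperStable : Graph → Match → Set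
  SuperStable F M = IsMatching F M × (∀ a b → F a b → ¬ Blocks M a b)

  AddPair : Match → Fin nA → Fin nB → Match
  AddPair M m w a b = M a b ⊎ (a ≡ m × b ≡ w)

  -- Edge relation of the reduced graph G' w.r.t. (m, w).  The vertices m and w
  -- are kept as isolated vertices (all their edges are deleted), which does
  -- not affect matchings or blocking edges.
  Reduced : Fin nA → Fin nB → Graph
  Reduced m w m' w' =
    E m' w' × m' ≢ m × w' ≢ w ×
    ¬ (E m' w × m' ⪰ᴮ[ w ] m × w ⪰ᴬ[ m' ] w') ×
    ¬ (E m w' × w' ⪰ᴬ[ m ] w × m ⪰ᴮ[ w' ] m')

-- Two super-stable matchings M and N of the same graph match the same men and
-- the same women.  If a man is matched in M but single in N, super-stability of
-- N and then of M makes "M-partner, then her N-partner" an endless walk through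
-- men who each strictly prefer their M-partner to their N-partners.  The walk
-- never repeats a man, since its step is injective and its start has no
-- predecessor, so it cannot exist among finitely many men.  Constructively the
-- walk is only available under a double negation, which suffices as the goal
-- is absurdity.
--
-- Now let N' be super-stable in G'.  An edge (m, b) with b ⪰_m w blocks
-- N' ∪ {(m, w)} only if b is single in N' or m ⪰_b N'(b); the latter edge
-- (N'(b), b) was deleted by the reduction, and in the former case b is single
-- in M' as well, so (m, b) blocks M' ∪ {(m, w)}.  Edges at w are symmetric, and
-- every other edge of G either lies in G' or would make an edge at m or w
-- block.  Conversely, a super-stable matching of G containing (m, w) minus that
-- pair is super-stable in G'.
module Submission where

open import Defs
open import Data.Fin using (Fin; toℕ; _≟_)
open import Data.Fin.Properties using (pigeonhole; sequence)
open import Data.Nat using (ℕ; zero; suc; _≤_; _<_; s≤s)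
open import Data.Nat.Properties using (≤-trans; <⇒≤; <⇒≢; ≮⇒≥; n<1+n)
open import Data.Product using (_×_; Σ; ∃; _,_; proj₁; proj₂; uncurry)
import Data.Product as Product
open import Data.Sum using (inj₁; inj₂)
open import Data.Empty using (⊥; ⊥-elim)
open import Effect.Monad using (RawMonad)
import Level
open import Function using (_∘_; flip)
open import Relation.Nullary using (¬_; yes; no)
open import Relation.Nullary.Negation using (¬¬-Monad)
open import Relation.Binary.PropositionalEquality using (_≡_; _≢_; refl; sym; subst)

open RawMonad (¬¬-Monad {a = Level.zero}) using (rawApplicative; pure; _>>=_)

¬¬-under-premise : {A B : Set} → (A → ¬ ¬ B) → ¬ ¬ (A → B)
¬¬-under-premise f ¬[A→B] = ¬[A→B] λ a → ⊥-elim (f a (¬[A→B] ∘ λ b _ → b))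

¬∀≥⇒¬¬∃< : {A : Set} {P : A → Set} {r : A → ℕ} {k : ℕ} →
           ¬ (∀ x → P x → k ≤ r x) → ¬ ¬ (∃ λ x → P x × r x < k)
¬∀≥⇒¬¬∃< ¬all none = ¬all λ x Px → ≮⇒≥ λ rx<k → none (x , Px , rx<k)

module _ {n : ℕ} {R : Fin n → Fin n → Set}
         (R-injective : ∀ {a c b} → R a b → R c b → a ≡ c) where

  no-injective-chain-from-source : (f : ℕ → Fin n) → (∀ i → R (f i) (f (suc i))) →
                                   (∀ a → ¬ R a (f 0)) → ⊥
  no-injective-chain-from-source f chain source =
    let i , j , i<j , fi≡fj = pigeonhole (n<1+n n) (f ∘ toℕ)
    in distinct (toℕ i) (toℕ j) i<j fi≡fj
    where
    distinct : ∀ i j → i < j → f i ≢ f j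
    distinct zero    (suc j) _         f0≡f1+j = source (f j) (subst (R (f j)) (sym f0≡f1+j) (chain j))
    distinct (suc i) (suc j) (s≤s i<j) f1+i≡f1+j =
      distinct i j i<j (R-injective (subst (R (f i)) f1+i≡f1+j (chain i)) (chain j))

  no-persistent-chain-from-source : {P : Fin n → Set} →
    (∀ a → P a → ¬ ¬ (∃ λ a' → R a a' × P a')) →
    ∀ {x} → P x → (∀ a → ¬ R a x) → ⊥
  no-persistent-chain-from-source {P} step {x} Px source =
    sequence rawApplicative (λ a → ¬¬-under-premise (step a)) λ next →
      no-injective-chain-from-source (proj₁ ∘ walk next)
        (proj₁ ∘ proj₂ ∘ uncurry next ∘ walk next) source
    where
    walk : (∀ a → P a → ∃ λ a' → R a a' × P a') → ℕ → ∃ P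
    walk next zero    = x , Px
    walk next (suc i) = Product.map₂ proj₂ (uncurry next (walk next i))

module SuperStableParts {I : Instance} {F : Graph I} {M : Match I}
                        (M-ss : SuperStable I F M) where
  open Instance I

  edges : ∀ a b → M a b → F a b
  edges = proj₁ (proj₁ M-ss)

  functional : ∀ a b b' → M a b → M a b' → b ≡ b'
  functional = proj₁ (proj₂ (proj₁ M-ss))

  injective : ∀ a a' b → M a b → M a' b → a ≡ a'
  injective = proj₂ (proj₂ (proj₁ M-ss))

  stable : ∀ a b → F a b → ¬ Blocks I M a b
  stable = proj₂ M-ss

module _ {I : Instance} {F : Graph I} {M N : Match I}
         (M-ss : SuperStable I F M) (N-ss : SuperStable I F N) where
  open Instance I
  private
    module Mˢ = SuperStableParts {I} {F} {M} M-ss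
    module Nˢ = SuperStableParts {I} {F} {N} N-ss

    ImprovesInM : Fin nA → Set
    ImprovesInM a = ∃ λ b → M a b × (∀ b' → N a b' → rankA a b < rankA a b')

    Next : Fin nA → Fin nA → Set
    Next a a' = ∃ λ b → M a b × N a' b

    Next-injective : ∀ {a c a'} → Next a a' → Next c a' → a ≡ c
    Next-injective {a} {c} {a'} (b , Mab , Na'b) (b' , Mcb' , Na'b')
      with refl ← Nˢ.functional a' b b' Na'b Na'b' = Mˢ.injective a c b Mab Mcb'

    improvesInM-next : ∀ a → ImprovesInM a → ¬ ¬ (∃ λ a' → Next a a' × ImprovesInM a')
    improvesInM-next a (b , Mab , b≻N[a]) = do
      a' , Na'b , a'≻a ← ¬∀≥⇒¬¬∃< λ a⪰N[b] →
        Nˢ.stable a b (Mˢ.edges a b Mab) (¬Nab , (λ b' → <⇒≤ ∘ b≻N[a] b') , a⪰N[b])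
      b'' , Ma'b'' , b''≻b ← ¬∀≥⇒¬¬∃< λ b⪰M[a'] →
        Mˢ.stable a' b (Nˢ.edges a' b Na'b) (above-a⇒¬M a'≻a , b⪰M[a'] , above-a⇒⪰M a'≻a)
      pure (a' , (b , Mab , Na'b) , b'' , Ma'b'' , λ b' Na'b' →
        subst (λ z → rankA a' b'' < rankA a' z) (Nˢ.functional a' b b' Na'b Na'b') b''≻b)
      where
      ¬Nab : ¬ N a b
      ¬Nab Nab = <⇒≢ (b≻N[a] b Nab) refl

      above-a⇒¬M : ∀ {a'} → rankB b a' < rankB b a → ¬ M a' b
      above-a⇒¬M a'≻a Ma'b with refl ← Mˢ.injective _ a b Ma'b Mab = <⇒≢ a'≻a refl

      above-a⇒⪰M : ∀ {a'} → rankB b a' < rankB b a →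
                   ∀ a'' → M a'' b → rankB b a' ≤ rankB b a''
      above-a⇒⪰M a'≻a a'' Ma''b with refl ← Mˢ.injective a'' a b Ma''b Mab = <⇒≤ a'≻a

  superStable-man-stays-matched : ∀ {x y} → M x y → ¬ ¬ (∃ λ y' → N x y')
  superStable-man-stays-matched {y = y} Mxy single =
    no-persistent-chain-from-source Next-injective improvesInM-next
      (y , Mxy , λ y' Nxy' → ⊥-elim (single (y' , Nxy')))
      (λ a (b , _ , Nxb) → single (b , Nxb))

transpose : Instance → Instance
transpose I = record { nA = nB ; nB = nA ; E = flip E ; rankA = rankB ; rankB = rankA }
  where open Instance I

superStable-transpose : ∀ {I F} {M : Match I} →
  SuperStable I F M → SuperStable (transpose I) (flip F) (flip M)
superStable-transpose ((M⊆F , M-functional , M-injective) , M-stable) =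
  ( (λ b a → M⊆F a b)
  , (λ b a a' → M-injective a a' b)
  , (λ b b' a → M-functional a b b') )
  , λ b a Fab (¬Mab , a⪰M[b] , b⪰M[a]) → M-stable a b Fab (¬Mab , b⪰M[a] , a⪰M[b])

superStable-woman-stays-matched : ∀ {I F} {M N : Match I} →
  SuperStable I F M → SuperStable I F N → ∀ {x y} → M x y → ¬ ¬ (∃ λ x' → N x' y)
superStable-woman-stays-matched {I} {F} {M} {N} M-ss N-ss =
  superStable-man-stays-matched {transpose I} {flip F} {flip M} {flip N}
    (superStable-transpose {I} {F} {M} M-ss) (superStable-transpose {I} {F} {N} N-ss)

Blocks-antitone : ∀ {I} {M N : Match I} → (∀ a b → M a b → N a b) →
                  ∀ {a b} → Blocks I N a b → Blocks I M a b
Blocks-antitone M⊆N (¬Nab , b⪰N[a] , a⪰N[b]) =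
  ¬Nab ∘ M⊆N _ _ , (λ b' → b⪰N[a] b' ∘ M⊆N _ _) , (λ a' → a⪰N[b] a' ∘ M⊆N _ _)

module _ (I : Instance) where
  open Instance I

  reduced-avoids : ∀ {m w a b} → Reduced I m w a b → a ≢ m × b ≢ w
  reduced-avoids (_ , a≢m , b≢w , _) = a≢m , b≢w

  addPair-isMatching : ∀ {m w} {N' : Match I} → E m w →
                       IsMatching I (Reduced I m w) N' → IsMatching I E (AddPair I N' m w)
  addPair-isMatching {m} {w} {N'} Emw (N'⊆G' , N'-functional , N'-injective) =
    edges , functional , injective
    where
    avoids : ∀ {a b} → N' a b → a ≢ m × b ≢ w
    avoids {a} {b} = reduced-avoids ∘ N'⊆G' a b

    edges : ∀ a b → AddPair I N' m w a b → E a b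
    edges a b (inj₁ N'ab)          = proj₁ (N'⊆G' a b N'ab)
    edges a b (inj₂ (refl , refl)) = Emw

    functional : ∀ a b b' → AddPair I N' m w a b → AddPair I N' m w a b' → b ≡ b'
    functional a b b' (inj₁ N'ab)      (inj₁ N'ab')     = N'-functional a b b' N'ab N'ab'
    functional a b b' (inj₁ N'ab)      (inj₂ (a≡m , _)) = ⊥-elim (proj₁ (avoids N'ab) a≡m)
    functional a b b' (inj₂ (a≡m , _)) (inj₁ N'ab')     = ⊥-elim (proj₁ (avoids N'ab') a≡m)
    functional a b b' (inj₂ (_ , refl)) (inj₂ (_ , refl)) = refl

    injective : ∀ a a' b → AddPair I N' m w a b → AddPair I N' m w a' b → a ≡ a'
    injective a a' b (inj₁ N'ab)      (inj₁ N'a'b)     = N'-injective a a' b N'ab N'a'b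
    injective a a' b (inj₁ N'ab)      (inj₂ (_ , b≡w)) = ⊥-elim (proj₂ (avoids N'ab) b≡w)
    injective a a' b (inj₂ (_ , b≡w)) (inj₁ N'a'b)     = ⊥-elim (proj₂ (avoids N'a'b) b≡w)
    injective a a' b (inj₂ (refl , _)) (inj₂ (refl , _)) = refl

  module _ {m w} {M' N' : Match I}
           (M'-ss : SuperStable I (Reduced I m w) M') (M-ss : SuperStable I E (AddPair I M' m w))
           (N'-ss : SuperStable I (Reduced I m w) N') where
    private
      G' : Graph I
      G' = Reduced I m w

      module Mˢ  = SuperStableParts {I} {E} {AddPair I M' m w} M-ss
      module M'ˢ = SuperStableParts {I} {G'} {M'} M'-ss
      module N'ˢ = SuperStableParts {I} {G'} {N'} N'-ss

      N : Match I
      N = AddPair I N' m w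

      M'-avoids : ∀ {a b} → M' a b → a ≢ m × b ≢ w
      M'-avoids {a} {b} = reduced-avoids ∘ M'ˢ.edges a b

      N'-avoids : ∀ {a b} → N' a b → a ≢ m × b ≢ w
      N'-avoids {a} {b} = reduced-avoids ∘ N'ˢ.edges a b

    addPair-unblocked-at-m : ∀ {b} → b ≢ w → E m b → ¬ Blocks I N m b
    addPair-unblocked-at-m {b} b≢w Emb (_ , b⪰N[m] , m⪰N[b]) = b-matched-in-N' λ (a' , N'a'b) →
      let (_ , _ , _ , _ , m-side) = N'ˢ.edges a' b N'a'b
      in m-side (Emb , b⪰w , m⪰N[b] a' (inj₁ N'a'b))
      where
      b⪰w : rankA m b ≤ rankA m w
      b⪰w = b⪰N[m] w (inj₂ (refl , refl))

      -- otherwise b is single in M' too, and (m , b) blocks M' ∪ {(m , w)}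
      b-matched-in-N' : ¬ ¬ (∃ λ a' → N' a' b)
      b-matched-in-N' single = Mˢ.stable m b Emb
        ( (λ { (inj₁ M'mb) → proj₁ (M'-avoids M'mb) refl ; (inj₂ (_ , b≡w)) → b≢w b≡w })
        , (λ { b' (inj₁ M'mb') → ⊥-elim (proj₁ (M'-avoids M'mb') refl)
             ; b' (inj₂ (_ , refl)) → b⪰w })
        , (λ { a' (inj₁ M'a'b) →
                 ⊥-elim (superStable-woman-stays-matched {I} {G'} {M'} {N'} M'-ss N'-ss M'a'b single)
             ; a' (inj₂ (_ , b≡w)) → ⊥-elim (b≢w b≡w) }))

    addPair-unblocked-at-w : ∀ {a} → a ≢ m → E a w → ¬ Blocks I N a w
    addPair-unblocked-at-w {a} a≢m Eaw (_ , w⪰N[a] , a⪰N[w]) = a-matched-in-N' λ (b' , N'ab') →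
      let (_ , _ , _ , w-side , _) = N'ˢ.edges a b' N'ab'
      in w-side (Eaw , a⪰m , w⪰N[a] b' (inj₁ N'ab'))
      where
      a⪰m : rankB w a ≤ rankB w m
      a⪰m = a⪰N[w] m (inj₂ (refl , refl))

      a-matched-in-N' : ¬ ¬ (∃ λ b' → N' a b')
      a-matched-in-N' single = Mˢ.stable a w Eaw
        ( (λ { (inj₁ M'aw) → proj₂ (M'-avoids M'aw) refl ; (inj₂ (a≡m , _)) → a≢m a≡m })
        , (λ { b' (inj₁ M'ab') →
                 ⊥-elim (superStable-man-stays-matched {I} {G'} {M'} {N'} M'-ss N'-ss M'ab' single)
             ; b' (inj₂ (a≡m , _)) → ⊥-elim (a≢m a≡m) })
        , (λ { a' (inj₁ M'a'w) → ⊥-elim (proj₂ (M'-avoids M'a'w) refl)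
             ; a' (inj₂ (refl , _)) → a⪰m }))

    addPair-unblocked : ∀ a b → E a b → ¬ Blocks I N a b
    addPair-unblocked a b Eab blocks@(_ , b⪰N[a] , a⪰N[b]) with a ≟ m | b ≟ w
    ... | yes refl | yes refl = proj₁ blocks (inj₂ (refl , refl))
    ... | yes refl | no b≢w   = addPair-unblocked-at-m b≢w Eab blocks
    ... | no a≢m   | yes refl = addPair-unblocked-at-w a≢m Eab blocks
    ... | no a≢m   | no b≢w   =
      N'ˢ.stable a b (Eab , a≢m , b≢w , w-side , m-side)
        (Blocks-antitone {I} {N'} {N} (λ _ _ → inj₁) blocks)
      where
      -- with w ⪰_a b and a ⪰_w m, a blocking edge (a , b) makes (a , w) block N too
      w-side : ¬ (E a w × rankB w a ≤ rankB w m × rankA a w ≤ rankA a b)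
      w-side (Eaw , a⪰m , w⪰b) = addPair-unblocked-at-w a≢m Eaw
        ( (λ { (inj₁ N'aw) → proj₂ (N'-avoids N'aw) refl ; (inj₂ (a≡m , _)) → a≢m a≡m })
        , (λ b' Nab' → ≤-trans w⪰b (b⪰N[a] b' Nab'))
        , (λ { a' (inj₁ N'a'w) → ⊥-elim (proj₂ (N'-avoids N'a'w) refl)
             ; a' (inj₂ (refl , _)) → a⪰m }))

      m-side : ¬ (E m b × rankA m b ≤ rankA m w × rankB b m ≤ rankB b a)
      m-side (Emb , b⪰w , m⪰a) = addPair-unblocked-at-m b≢w Emb
        ( (λ { (inj₁ N'mb) → proj₁ (N'-avoids N'mb) refl ; (inj₂ (_ , b≡w)) → b≢w b≡w })
        , (λ { b' (inj₁ N'mb') → ⊥-elim (proj₁ (N'-avoids N'mb') refl)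
             ; b' (inj₂ (_ , refl)) → b⪰w })
        , (λ a' Na'b → ≤-trans m⪰a (a⪰N[b] a' Na'b)))

    superStable-addPair : E m w → SuperStable I E (AddPair I N' m w)
    superStable-addPair Emw = addPair-isMatching Emw (proj₁ N'-ss) , addPair-unblocked

  superStable-reduced-restriction : ∀ {m w} {M : Match I} → SuperStable I E M → M m w →
    SuperStable I (Reduced I m w) (λ a b → M a b × a ≢ m)
  superStable-reduced-restriction {m} {w} {M} M-ss Mmw =
    ( inReduced
    , (λ a b b' (Mab , _) (Mab' , _) → Mˢ.functional a b b' Mab Mab')
    , (λ a a' b (Mab , _) (Ma'b , _) → Mˢ.injective a a' b Mab Ma'b) )
    , λ a b (Eab , a≢m , b≢w , _) (¬M'ab , b⪰M'[a] , a⪰M'[b]) → Mˢ.stable a b Eab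
        ( (λ Mab → ¬M'ab (Mab , a≢m))
        , (λ b' Mab' → b⪰M'[a] b' (Mab' , a≢m))
        , (λ a' Ma'b → a⪰M'[b] a' (Ma'b , λ { refl → b≢w (Mˢ.functional m b w Ma'b Mmw) })) )
    where
    module Mˢ = SuperStableParts {I} {E} {M} M-ss

    avoids-w : ∀ {a b} → M a b → a ≢ m → b ≢ w
    avoids-w {a} Mab a≢m refl = a≢m (Mˢ.injective a m w Mab Mmw)

    inReduced : ∀ a b → M a b × a ≢ m → Reduced I m w a b
    inReduced a b (Mab , a≢m) = Mˢ.edges a b Mab , a≢m , avoids-w Mab a≢m , w-side , m-side
      where
      w-side : ¬ (E a w × rankB w a ≤ rankB w m × rankA a w ≤ rankA a b)
      w-side (Eaw , a⪰m , w⪰b) = Mˢ.stable a w Eaw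
        ( (λ Maw → a≢m (Mˢ.injective a m w Maw Mmw))
        , (λ b' Mab' → subst (λ z → rankA a w ≤ rankA a z) (Mˢ.functional a b b' Mab Mab') w⪰b)
        , (λ a' Ma'w → subst (λ z → rankB w a ≤ rankB w z) (Mˢ.injective m a' w Mmw Ma'w) a⪰m) )

      m-side : ¬ (E m b × rankA m b ≤ rankA m w × rankB b m ≤ rankB b a)
      m-side (Emb , b⪰w , m⪰a) = Mˢ.stable m b Emb
        ( (λ Mmb → avoids-w Mab a≢m (Mˢ.functional m b w Mmb Mmw))
        , (λ b' Mmb' → subst (λ z → rankA m b ≤ rankA m z) (Mˢ.functional m w b' Mmw Mmb') b⪰w)
        , (λ a' Ma'b → subst (λ z → rankB b m ≤ rankB b z) (Mˢ.injective a a' b Mab Ma'b) m⪰a) )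

mainTheorem3 : (I : Instance) → let open Instance I in
    (m : Fin nA) (w : Fin nB) → E m w →
    ((M' : Match I) → SuperStable I (Reduced I m w) M' →
       SuperStable I E (AddPair I M' m w) →
       (N' : Match I) → SuperStable I (Reduced I m w) N' →
       SuperStable I E (AddPair I N' m w))
    ×
    (¬ (Σ (Match I) λ N' → SuperStable I (Reduced I m w) N') →
       ¬ (Σ (Match I) λ M → SuperStable I E M × M m w))
mainTheorem3 I m w Emw =
  (λ M' M'-ss M-ss N' N'-ss → superStable-addPair I M'-ss M-ss N'-ss Emw)
  , λ no-ss-of-G' (M , M-ss , Mmw) → no-ss-of-G' (_ , superStable-reduced-restriction I M-ss Mmw)
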